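{- Let $P$ be a periodic dealing pattern with period $p$ (i.e. $P_{i+p}=P_i$ for all $i$). Then for every $N\ge p$ and every $1\le k\le p$: \[T^P_{N,k}=|P_k|_D \ \text{ if } P_k=D,\qquad T^P_{N,k}=T^P_{N-|P_p|_D,\;N-p+|P_k|_U}+|P_p|_D \ \text{ if } P_k=U.\]
   Context: A dealing pattern $P=P_1P_2P_3\cdots$ is an infinite sequence of letters $U$ and $D$ containing infinitely many $D$'s; $P_k$ is its $k$th letter. Dealing a deck of $N$ cards (positions $1,\dots,N$ from the top) by $P$ means: process the letters in order; for a $U$ move the top card to the bottom; for a $D$ remove the top card (deal it); stop when all $N$ cards are dealt. For $1\le k\le N$, $T^P_{N,k}$ is the number $j$ such that the card initially at position $k$ is the $j$th card dealt. $|P_m|_D$, $|P_m|_U$ denote the number of $D$'s, resp. $U$'s, among the first $m$ letters of $P$. -}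

module Defs where

open import Data.Nat using (ℕ; zero; suc; _+_; _≤_)
open import Data.List using (List; []; _∷_; _++_; [_]; map; upTo)
open import Data.Maybe using (Maybe; just; nothing)
open import Data.Product using (_×_; _,_; ∃)
open import Relation.Binary.PropositionalEquality using (_≡_)

data Letter : Set where
  U D : Letter

-- A pattern P = P₁P₂P₃⋯ is a function ℕ → Letter, read 1-based:
-- P k is the k-th letter P_k (the value P 0 is never used).
Pattern : Set
Pattern = ℕ → Letter

InfinitelyManyD : Pattern → Set
InfinitelyManyD P = ∀ m → ∃ λ n → (m ≤ n) × (1 ≤ n) × (P n ≡ D)

countD : Pattern → ℕ → ℕ
countD P zero = 0
countD P (suc m) with P (suc m)
... | D = suc (countD P m)
... | U = countD P m

countU : Pattern → ℕ → ℕ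
countU P zero = 0
countU P (suc m) with P (suc m)
... | U = suc (countU P m)
... | D = countU P m

-- State of the dealing: (current deck top-to-bottom, dealt cards in order).
State : Set
State = List ℕ × List ℕ

step : Letter → State → State
step _ ([] , dealt) = ([] , dealt)
step U (x ∷ xs , dealt) = (xs ++ [ x ] , dealt)
step D (x ∷ xs , dealt) = (xs , dealt ++ [ x ])

-- Deck of N cards labelled by their initial positions 1,…,N (top first).
deck : ℕ → List ℕ
deck N = map suc (upTo N)

run : Pattern → ℕ → ℕ → State
run P N zero = (deck N , [])
run P N (suc m) = step (P (suc m)) (run P N m)

at : List ℕ → ℕ → Maybe ℕ
at [] _ = nothing
at (x ∷ xs) zero = nothing
at (x ∷ xs) (suc zero) = just x
at (x ∷ xs) (suc (suc j)) = at xs (suc j)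

-- IsT P N k j  :⇔  T^P_{N,k} = j, i.e. the card initially at position k
-- is the j-th card dealt when dealing N cards by P.
IsT : Pattern → ℕ → ℕ → ℕ → Set
IsT P N k j = ∃ λ m → at (Data.Product.proj₂ (run P N m)) j ≡ just k

{-# OPTIONS --safe #-}
module Submission where

-- While the first p ≤ N letters are read the deck never wraps around, so the
-- card at position i is dealt or moved to the bottom exactly when P_i is read:
-- afterwards the dealt pile lists the D-positions i ≤ p in order, and the deck
-- is the N − p untouched cards followed by the U-positions i ≤ p, i.e.
-- N − |P_p|_D cards, with k (for P_k = U) at position N − p + |P_k|_U.  By
-- periodicity the rest of the process is the dealing of this deck by P itself,
-- up to relabelling the cards, and every card of it is eventually dealt since
-- P has infinitely many D's.

open import Defs
open import Data.Nat using (ℕ; zero; suc; pred; _+_; _∸_; _≤_; _<_; _≤′_; ≤′-refl; ≤′-step; z≤n; s≤s)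
open import Data.Nat.Properties
open import Data.Product using (_×_; ∃; _,_; proj₁; proj₂)
open import Data.List using (List; []; _∷_; _++_; [_]; _∷ʳ_; map; upTo; applyUpTo; length)
open import Data.List.Properties using (++-assoc; ++-identityʳ; map-++; length-++; map-upTo; map-applyUpTo)
open import Data.List.Membership.Propositional using (_∈_)
open import Data.List.Membership.Propositional.Properties using (∈-map⁺; ∈-upTo⁺)
open import Data.List.Relation.Unary.Any using (here; there)
open import Data.List.Relation.Binary.Permutation.Propositional
  using (_↭_; ↭-refl; ↭-reflexive; ↭-sym; ↭-trans)
open import Data.List.Relation.Binary.Permutation.Propositional.Properties using (∈-resp-↭; shift; ++⁺ˡ; ∷↭∷ʳ)
open import Data.Maybe using (just; fromMaybe)
open import Relation.Binary.PropositionalEquality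
  using (_≡_; refl; sym; trans; cong; cong₂; subst; subst₂; module ≡-Reasoning)

at-∷ : ∀ x xs {j v} → at xs j ≡ just v → at (x ∷ xs) (suc j) ≡ just v
at-∷ x (_ ∷ _) {suc _} h = h

at-++ˡ : ∀ xs {ys j v} → at xs j ≡ just v → at (xs ++ ys) j ≡ just v
at-++ˡ (x ∷ xs) {j = suc zero}    h = h
at-++ˡ (x ∷ xs) {j = suc (suc j)} h = at-++ˡ xs h

at-++ʳ : ∀ xs {ys j v} → at ys j ≡ just v → at (xs ++ ys) (length xs + j) ≡ just v
at-++ʳ []       h = h
at-++ʳ (x ∷ xs) {ys} h = at-∷ x (xs ++ ys) (at-++ʳ xs h)

at-∷ʳ : ∀ xs x → at (xs ∷ʳ x) (length (xs ∷ʳ x)) ≡ just x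
at-∷ʳ xs x = subst (λ n → at (xs ∷ʳ x) n ≡ just x) (sym (length-++ xs)) (at-++ʳ xs refl)

at-map : ∀ (f : ℕ → ℕ) xs {j v} → at xs j ≡ just v → at (map f xs) j ≡ just (f v)
at-map f (x ∷ xs) {suc zero}    refl = refl
at-map f (x ∷ xs) {suc (suc j)} h    = at-map f xs h

∈⇒at : ∀ {x xs} → x ∈ xs → ∃ λ j → at xs j ≡ just x
∈⇒at (here refl) = 1 , refl
∈⇒at {xs = y ∷ ys} (there x∈ys) with j , h ← ∈⇒at x∈ys = suc j , at-∷ y ys h

at-suc⇒< : ∀ xs {i v} → at xs (suc i) ≡ just v → i < length xs
at-suc⇒< (x ∷ xs) {zero}  _ = s≤s z≤n
at-suc⇒< (x ∷ xs) {suc i} h = s≤s (at-suc⇒< xs h)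

at⇒∈-deck : ∀ xs {j v} → at xs j ≡ just v → j ∈ deck (length xs)
at⇒∈-deck (x ∷ xs) {suc i} h = ∈-map⁺ suc (∈-upTo⁺ (at-suc⇒< (x ∷ xs) h))

-- The card at 1-based position c of xs, with the junk value 0 out of range.
relabel : List ℕ → ℕ → ℕ
relabel xs c = fromMaybe 0 (at xs c)

relabel-at : ∀ xs {j v} → at xs j ≡ just v → relabel xs j ≡ v
relabel-at xs = cong (fromMaybe 0)

applyUpTo-relabel : ∀ xs → applyUpTo (λ i → relabel xs (suc i)) (length xs) ≡ xs
applyUpTo-relabel []       = refl
applyUpTo-relabel (x ∷ xs) = cong (x ∷_) (applyUpTo-relabel xs)

map-relabel-deck : ∀ xs → map (relabel xs) (deck (length xs)) ≡ xs
map-relabel-deck xs = begin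
  map (relabel xs) (map suc (upTo (length xs)))    ≡⟨ cong (map (relabel xs)) (map-upTo suc (length xs)) ⟩
  map (relabel xs) (applyUpTo suc (length xs))     ≡⟨ map-applyUpTo suc (relabel xs) (length xs) ⟩
  applyUpTo (λ i → relabel xs (suc i)) (length xs) ≡⟨ applyUpTo-relabel xs ⟩
  xs                                               ∎
  where open ≡-Reasoning

interval : ℕ → ℕ → List ℕ
interval a zero    = []
interval a (suc n) = a ∷ interval (suc a) n

length-interval : ∀ a n → length (interval a n) ≡ n
length-interval a zero    = refl
length-interval a (suc n) = cong suc (length-interval (suc a) n)

applyUpTo-interval : ∀ f a n → (∀ i → f i ≡ a + i) → applyUpTo f n ≡ interval a n
applyUpTo-interval f a zero    f≗a+ = refl
applyUpTo-interval f a (suc n) f≗a+ = cong₂ _∷_ (trans (f≗a+ 0) (+-identityʳ a))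
  (applyUpTo-interval (λ i → f (suc i)) (suc a) n (λ i → trans (f≗a+ (suc i)) (+-suc a i)))

deck≡interval : ∀ N → deck N ≡ interval 1 N
deck≡interval N = trans (map-upTo suc N) (applyUpTo-interval suc 1 N (λ _ → refl))

length-deck : ∀ N → length (deck N) ≡ N
length-deck N = trans (cong length (deck≡interval N)) (length-interval 1 N)

m∸[n+o]+o≡m∸n : ∀ m n o → n + o ≤ m → m ∸ (n + o) + o ≡ m ∸ n
m∸[n+o]+o≡m∸n m n o n+o≤m = begin
  m ∸ (n + o) + o ≡⟨ cong (_+ o) (sym (∸-+-assoc m n o)) ⟩
  m ∸ n ∸ o + o   ≡⟨ m∸n+n≡m (m+n≤o⇒m≤o∸n o (subst (_≤ m) (+-comm n o) n+o≤m)) ⟩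
  m ∸ n           ∎
  where open ≡-Reasoning

length≤0⇒≡[] : ∀ (xs : List ℕ) → length xs ≤ 0 → xs ≡ []
length≤0⇒≡[] [] _ = refl

cards : State → List ℕ
cards (xs , ys) = xs ++ ys

cards-step : ∀ ℓ s → cards (step ℓ s) ↭ cards s
cards-step U ([] , ys)     = ↭-refl
cards-step D ([] , ys)     = ↭-refl
cards-step U (x ∷ xs , ys) = ↭-trans (↭-reflexive (++-assoc xs [ x ] ys)) (shift x xs ys)
cards-step D (x ∷ xs , ys) = ↭-trans (++⁺ˡ xs (↭-sym (∷↭∷ʳ x ys))) (shift x xs ys)

cards-run : ∀ P M m → cards (run P M m) ↭ deck M
cards-run P M zero    = ↭-reflexive (++-identityʳ (deck M))
cards-run P M (suc m) = ↭-trans (cards-step (P (suc m)) (run P M m)) (cards-run P M m)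

length-step-≤ : ∀ ℓ s → length (proj₁ (step ℓ s)) ≤ length (proj₁ s)
length-step-≤ _ ([] , _)     = z≤n
length-step-≤ U (x ∷ xs , _) = ≤-reflexive (trans (length-++ xs) (+-comm (length xs) 1))
length-step-≤ D (x ∷ xs , _) = n≤1+n (length xs)

length-step-D : ∀ s → length (proj₁ (step D s)) ≡ pred (length (proj₁ s))
length-step-D ([] , _)     = refl
length-step-D (x ∷ xs , _) = refl

module Exhaustion (P : Pattern) (M : ℕ) where

  deckSize : ℕ → ℕ
  deckSize m = length (proj₁ (run P M m))

  deckSize-antitone : ∀ {m n} → m ≤′ n → deckSize n ≤ deckSize m
  deckSize-antitone ≤′-refl           = ≤-refl
  deckSize-antitone (≤′-step {n} m≤n) =
    ≤-trans (length-step-≤ (P (suc n)) (run P M n)) (deckSize-antitone m≤n)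

  deckSize-D : ∀ n → P (suc n) ≡ D → deckSize (suc n) ≡ pred (deckSize n)
  deckSize-D n Pn≡D rewrite Pn≡D = length-step-D (run P M n)

  deck-shrinks : InfinitelyManyD P → ∀ k → ∃ λ m → deckSize m ≤ M ∸ k
  deck-shrinks infD zero = 0 , ≤-reflexive (length-deck M)
  deck-shrinks infD (suc k) with m , shrunk ← deck-shrinks infD k | infD (suc m)
  ... | suc n , s≤s m≤n , _ , Pn≡D = suc n , (begin
    deckSize (suc n)   ≡⟨ deckSize-D n Pn≡D ⟩
    pred (deckSize n)  ≤⟨ pred-mono-≤ (≤-trans (deckSize-antitone (≤⇒≤′ m≤n)) shrunk) ⟩
    pred (M ∸ k)       ≡⟨ pred[m∸n]≡m∸[1+n] M k ⟩
    M ∸ suc k          ∎)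
    where open ≤-Reasoning

  deck-eventually-empty : InfinitelyManyD P → ∃ λ m → proj₁ (run P M m) ≡ []
  deck-eventually-empty infD with m , shrunk ← deck-shrinks infD M =
    m , length≤0⇒≡[] _ (subst (deckSize m ≤_) (n∸n≡0 M) shrunk)

  every-card-dealt : InfinitelyManyD P → ∀ {c} → c ∈ deck M → ∃ λ j → IsT P M c j
  every-card-dealt infD {c} c∈deck with m , empty ← deck-eventually-empty infD =
    let j , c-dealt = ∈⇒at c∈dealt in j , m , c-dealt
    where
    c∈dealt : c ∈ proj₂ (run P M m)
    c∈dealt = subst (λ xs → c ∈ xs ++ proj₂ (run P M m)) empty
                (∈-resp-↭ (↭-sym (cards-run P M m)) c∈deck)

open Exhaustion using (every-card-dealt)

-- A dealing of a smaller deck seen inside a bigger one: its cards are renamed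
-- by f, and the cards of pre were dealt beforehand.
embed : (ℕ → ℕ) → List ℕ → State → State
embed f pre s = map f (proj₁ s) , pre ++ map f (proj₂ s)

step-embed : ∀ f pre ℓ s → step ℓ (embed f pre s) ≡ embed f pre (step ℓ s)
step-embed f pre _ ([] , ys)     = refl
step-embed f pre U (x ∷ xs , ys) = cong (_, pre ++ map f ys) (sym (map-++ f xs [ x ]))
step-embed f pre D (x ∷ xs , ys) = cong (map f xs ,_)
  (trans (++-assoc pre (map f ys) [ f x ]) (cong (pre ++_) (sym (map-++ f ys [ x ]))))

module AfterOnePeriod {P : Pattern} {p : ℕ} (periodic : ∀ i → 1 ≤ i → P (i + p) ≡ P i) (N : ℕ) where

  deck₁ : List ℕ
  deck₁ = proj₁ (run P N p)

  dealt₁ : List ℕ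
  dealt₁ = proj₂ (run P N p)

  run-+-period : ∀ m → run P N (m + p) ≡ embed (relabel deck₁) dealt₁ (run P (length deck₁) m)
  run-+-period zero    = sym (cong₂ _,_ (map-relabel-deck deck₁) (++-identityʳ dealt₁))
  run-+-period (suc m) = trans (cong₂ step (periodic (suc m) (s≤s z≤n)) (run-+-period m))
    (step-embed (relabel deck₁) dealt₁ (P (suc m)) (run P (length deck₁) m))

  IsT-+-period : ∀ {c j} → IsT P (length deck₁) c j → IsT P N (relabel deck₁ c) (length dealt₁ + j)
  IsT-+-period (m , c-dealt) = m + p ,
    subst (λ s → at (proj₂ s) _ ≡ _) (sym (run-+-period m))
      (at-++ʳ dealt₁ (at-map (relabel deck₁) (proj₂ (run P (length deck₁) m)) c-dealt))

appendIfSame : Letter → Letter → ℕ → List ℕ → List ℕ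
appendIfSame U U i is = is ∷ʳ i
appendIfSame D D i is = is ∷ʳ i
appendIfSame _ _ i is = is

positions : Pattern → Letter → ℕ → List ℕ
positions P ℓ zero    = []
positions P ℓ (suc i) = appendIfSame ℓ (P (suc i)) (suc i) (positions P ℓ i)

module FirstPass (P : Pattern) where

  length-positions-D : ∀ i → length (positions P D i) ≡ countD P i
  length-positions-D zero = refl
  length-positions-D (suc i) with P (suc i)
  ... | D = trans (length-++ (positions P D i)) (trans (+-comm _ 1) (cong suc (length-positions-D i)))
  ... | U = length-positions-D i

  length-positions-U : ∀ i → length (positions P U i) ≡ countU P i
  length-positions-U zero = refl
  length-positions-U (suc i) with P (suc i)
  ... | U = trans (length-++ (positions P U i)) (trans (+-comm _ 1) (cong suc (length-positions-U i)))
  ... | D = length-positions-U i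

  countD+countU : ∀ i → countD P i + countU P i ≡ i
  countD+countU zero = refl
  countD+countU (suc i) with P (suc i)
  ... | U = trans (+-suc _ _) (cong suc (countD+countU i))
  ... | D = cong suc (countD+countU i)

  at-positions : ∀ {ℓ k} → 1 ≤ k → P k ≡ ℓ → at (positions P ℓ k) (length (positions P ℓ k)) ≡ just k
  at-positions {U} {suc k} _ Pk≡ℓ rewrite Pk≡ℓ = at-∷ʳ (positions P U k) (suc k)
  at-positions {D} {suc k} _ Pk≡ℓ rewrite Pk≡ℓ = at-∷ʳ (positions P D k) (suc k)

  at-positions-mono : ∀ {ℓ k i j v} → k ≤′ i →
    at (positions P ℓ k) j ≡ just v → at (positions P ℓ i) j ≡ just v
  at-positions-mono ≤′-refl h = h
  at-positions-mono {ℓ} (≤′-step {i} k≤i) h = at-appendIfSame ℓ (P (suc i)) (at-positions-mono k≤i h)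
    where
    at-appendIfSame : ∀ ℓ ℓ′ {is j v} → at is j ≡ just v → at (appendIfSame ℓ ℓ′ (suc i) is) j ≡ just v
    at-appendIfSame U U {is} = at-++ˡ is
    at-appendIfSame D D {is} = at-++ˡ is
    at-appendIfSame U D      = λ h → h
    at-appendIfSame D U      = λ h → h

  run-first-pass : ∀ {N i} → i ≤ N →
    run P N i ≡ (interval (suc i) (N ∸ i) ++ positions P U i , positions P D i)
  run-first-pass {N} {zero} _ = cong (_, []) (trans (deck≡interval N) (sym (++-identityʳ (interval 1 N))))
  run-first-pass {N} {suc i} i<N rewrite run-first-pass (<⇒≤ i<N) | +-∸-assoc 1 i<N with P (suc i)
  ... | U = cong (_, positions P D i)
                 (++-assoc (interval (suc (suc i)) (N ∸ suc i)) (positions P U i) [ suc i ])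
  ... | D = refl

  at-positions-D : ∀ {k i} → 1 ≤ k → k ≤ i → P k ≡ D → at (positions P D i) (countD P k) ≡ just k
  at-positions-D {k} 1≤k k≤i Pk≡D = at-positions-mono (≤⇒≤′ k≤i)
    (subst (λ n → at (positions P D k) n ≡ just k) (length-positions-D k) (at-positions 1≤k Pk≡D))

  at-positions-U : ∀ {k i} → 1 ≤ k → k ≤ i → P k ≡ U → at (positions P U i) (countU P k) ≡ just k
  at-positions-U {k} 1≤k k≤i Pk≡U = at-positions-mono (≤⇒≤′ k≤i)
    (subst (λ n → at (positions P U k) n ≡ just k) (length-positions-U k) (at-positions 1≤k Pk≡U))

  at-dealt-first-pass : ∀ {N i k} → i ≤ N → 1 ≤ k → k ≤ i → P k ≡ D →
    at (proj₂ (run P N i)) (countD P k) ≡ just k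
  at-dealt-first-pass i≤N 1≤k k≤i Pk≡D rewrite run-first-pass i≤N = at-positions-D 1≤k k≤i Pk≡D

  at-deck-first-pass : ∀ {N i k} → i ≤ N → 1 ≤ k → k ≤ i → P k ≡ U →
    at (proj₁ (run P N i)) (N ∸ i + countU P k) ≡ just k
  at-deck-first-pass {N} {i} {k} i≤N 1≤k k≤i Pk≡U rewrite run-first-pass i≤N =
    subst (λ n → at (interval (suc i) (N ∸ i) ++ positions P U i) (n + countU P k) ≡ just k)
      (length-interval (suc i) (N ∸ i))
      (at-++ʳ (interval (suc i) (N ∸ i)) (at-positions-U 1≤k k≤i Pk≡U))

  length-dealt-first-pass : ∀ {N i} → i ≤ N → length (proj₂ (run P N i)) ≡ countD P i
  length-dealt-first-pass {i = i} i≤N rewrite run-first-pass i≤N = length-positions-D i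

  length-deck-first-pass : ∀ {N i} → i ≤ N → length (proj₁ (run P N i)) ≡ N ∸ countD P i
  length-deck-first-pass {N} {i} i≤N rewrite run-first-pass i≤N = begin
    length (interval (suc i) (N ∸ i) ++ positions P U i)
      ≡⟨ length-++ (interval (suc i) (N ∸ i)) ⟩
    length (interval (suc i) (N ∸ i)) + length (positions P U i)
      ≡⟨ cong₂ _+_ (length-interval (suc i) (N ∸ i)) (length-positions-U i) ⟩
    N ∸ i + u
      ≡⟨ cong (λ t → N ∸ t + u) (sym (countD+countU i)) ⟩
    N ∸ (d + u) + u
      ≡⟨ m∸[n+o]+o≡m∸n N d u (subst (_≤ N) (sym (countD+countU i)) i≤N) ⟩
    N ∸ d
      ∎
    where
    open ≡-Reasoning
    d = countD P i
    u = countU P i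

mainTheorem14 : (P : Pattern) → InfinitelyManyD P →
    (p : ℕ) → 1 ≤ p → (∀ i → 1 ≤ i → P (i + p) ≡ P i) →
    (N : ℕ) → p ≤ N → (k : ℕ) → 1 ≤ k → k ≤ p →
      (P k ≡ D → IsT P N k (countD P k))
      × (P k ≡ U → ∃ λ j → IsT P (N ∸ countD P p) ((N ∸ p) + countU P k) j
                         × IsT P N k (j + countD P p))
mainTheorem14 P infD p _ periodic N p≤N k 1≤k k≤p = dealtCase , keptCase
  where
  open FirstPass P
  open AfterOnePeriod periodic N

  dealtCase : P k ≡ D → IsT P N k (countD P k)
  dealtCase Pk≡D = p , at-dealt-first-pass p≤N 1≤k k≤p Pk≡D

  k-at-deck₁ : P k ≡ U → at deck₁ (N ∸ p + countU P k) ≡ just k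
  k-at-deck₁ = at-deck-first-pass p≤N 1≤k k≤p

  keptCase : P k ≡ U →
    ∃ λ j → IsT P (N ∸ countD P p) (N ∸ p + countU P k) j × IsT P N k (j + countD P p)
  keptCase Pk≡U with j , T ← every-card-dealt P (length deck₁) infD (at⇒∈-deck deck₁ (k-at-deck₁ Pk≡U)) =
    j , subst (λ M → IsT P M (N ∸ p + countU P k) j) (length-deck-first-pass p≤N) T ,
    subst₂ (IsT P N) (relabel-at deck₁ (k-at-deck₁ Pk≡U))
      (trans (cong (_+ j) (length-dealt-first-pass p≤N)) (+-comm (countD P p) j)) (IsT-+-period T)
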